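{- Let $\mathbf{A}$ be a complete Heyting algebra and $\mathbb{X}=(W,R)$ an $\mathbf{A}$-Kripke frame. Then $\mathbb{X}$ is reflexive iff $I_R(w,(\alpha,v))\le I_\Delta(w,(\alpha,v))$ for all $w,v\in W$ and $\alpha\in\mathbf{A}$.
   Context: An $\mathbf{A}$-Kripke frame is $(W,R)$ with $W$ nonempty and $R:W\times W\to\mathbf{A}$; it is reflexive if $R(w,w)=\top$ for all $w\in W$. $\Delta(w,v)=\top$ if $w=v$ and $\bot$ otherwise. $I_R(w,(\alpha,v))=R(w,v)\to\alpha$ and $I_\Delta(w,(\alpha,v))=\Delta(w,v)\to\alpha$ for $w,v\in W$, $\alpha\in\mathbf{A}$. -}

module Defs where

open import Level using (Level; _⊔_; suc)
open import Relation.Binary.Lattice.Bundles using (HeytingAlgebra)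
open import Relation.Binary.PropositionalEquality using (_≡_)

-- A complete Heyting algebra: a Heyting algebra in which every family
-- indexed by a type of level ι has a least upper bound (hence also all
-- meets).  ι is the size of the index types allowed.
record CompleteHeytingAlgebra (c ℓ₁ ℓ₂ ι : Level) : Set (suc (c ⊔ ℓ₁ ⊔ ℓ₂ ⊔ ι)) where
  field
    heytingAlgebra : HeytingAlgebra c ℓ₁ ℓ₂
  open HeytingAlgebra heytingAlgebra public
  field
    ⋁         : {I : Set ι} → (I → Carrier) → Carrier
    ⋁-upper   : {I : Set ι} (f : I → Carrier) (i : I) → f i ≤ ⋁ f
    ⋁-least   : {I : Set ι} (f : I → Carrier) (x : Carrier) →
                ((i : I) → f i ≤ x) → ⋁ f ≤ x

module _ {c ℓ₁ ℓ₂ ι : Level} (A : CompleteHeytingAlgebra c ℓ₁ ℓ₂ ι) where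
  open CompleteHeytingAlgebra A

  record KripkeFrame : Set (c ⊔ suc ι) where
    field
      W        : Set ι
      inhabitant : W
      R        : W → W → Carrier

  module _ (X : KripkeFrame) where
    open KripkeFrame X

    Reflexive : Set (ι ⊔ ℓ₁)
    Reflexive = (w : W) → R w w ≈ ⊤

    -- Δ(w,v) = ⊤ if w = v, ⊥ otherwise; constructively rendered as the
    -- join ⋁_{p : w ≡ v} ⊤ (which is ⊤ when w = v and ⊥ when w ≠ v).
    Δ : W → W → Carrier
    Δ w v = ⋁ {I = w ≡ v} (λ _ → ⊤)

    I-R : W → Carrier → W → Carrier
    I-R w α v = R w v ⇨ α

    I-Δ : W → Carrier → W → Carrier
    I-Δ w α v = Δ w v ⇨ α

-- In a Heyting algebra, y ⇨ α ≤ x ⇨ α holds for every α exactly when x ≤ y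
-- (for the converse take α = y).  So the condition I_R ≤ I_Δ says Δ ≤ R
-- pointwise, and since Δ(w,v) is the join of ⊤ over the proofs of w ≡ v,
-- this amounts to R(w,w) = ⊤ for every w.
module Submission where

open import Defs
open import Level using (Level)
open import Data.Product using (_×_; _,_)
open import Relation.Binary.Lattice.Bundles using (HeytingAlgebra)
open import Relation.Binary.PropositionalEquality as ≡ using (_≡_)
import Relation.Binary.Lattice.Properties.HeytingAlgebra as HeytingAlgebraProperties

module _ {c ℓ₁ ℓ₂} (H : HeytingAlgebra c ℓ₁ ℓ₂) where
  open HeytingAlgebra H
  open HeytingAlgebraProperties H using (⇨-unit)

  ⊤≤x⇨y⇒x≤y : ∀ {x y} → ⊤ ≤ x ⇨ y → x ≤ y
  ⊤≤x⇨y⇒x≤y ⊤≤x⇨y = trans (∧-greatest (maximum _) refl) (transpose-∧ ⊤≤x⇨y)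

  ⇨ˡ-reflects-≤ : ∀ {x y} → (∀ α → y ⇨ α ≤ x ⇨ α) → x ≤ y
  ⇨ˡ-reflects-≤ {y = y} antitone =
    ⊤≤x⇨y⇒x≤y (trans (reflexive (Eq.sym ⇨-unit)) (antitone y))

module _ {c ℓ₁ ℓ₂ ι : Level} (A : CompleteHeytingAlgebra c ℓ₁ ℓ₂ ι) (X : KripkeFrame A) where
  open CompleteHeytingAlgebra A
  open KripkeFrame X

  ⊤≤Δ-refl : ∀ w → ⊤ ≤ Δ A X w w
  ⊤≤Δ-refl w = ⋁-upper _ ≡.refl

  Δ≤ : ∀ {w v x} → (w ≡ v → ⊤ ≤ x) → Δ A X w v ≤ x
  Δ≤ = ⋁-least _ _

  reflexive⇒Δ≤R : Reflexive A X → ∀ w v → Δ A X w v ≤ R w v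
  reflexive⇒Δ≤R R-refl w v = Δ≤ λ { ≡.refl → reflexive (Eq.sym (R-refl w)) }

  Δ≤R⇒reflexive : (∀ w → Δ A X w w ≤ R w w) → Reflexive A X
  Δ≤R⇒reflexive Δ≤R w = antisym (maximum _) (trans (⊤≤Δ-refl w) (Δ≤R w))

proposition5p8 : {c ℓ₁ ℓ₂ ι : Level} (A : CompleteHeytingAlgebra c ℓ₁ ℓ₂ ι)
    (X : KripkeFrame A) →
    (Reflexive A X →
    ((w v : KripkeFrame.W X) (α : CompleteHeytingAlgebra.Carrier A) →
    CompleteHeytingAlgebra._≤_ A (I-R A X w α v) (I-Δ A X w α v)))
    ×
    (((w v : KripkeFrame.W X) (α : CompleteHeytingAlgebra.Carrier A) →
    CompleteHeytingAlgebra._≤_ A (I-R A X w α v) (I-Δ A X w α v)) →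
    Reflexive A X)
proposition5p8 A X =
  (λ R-refl w v α → ⇨ˡ-contravariant (reflexive⇒Δ≤R A X R-refl w v))
  , λ I-R≤I-Δ → Δ≤R⇒reflexive A X λ w → ⇨ˡ-reflects-≤ heytingAlgebra (I-R≤I-Δ w w)
  where
  open CompleteHeytingAlgebra A using (heytingAlgebra)
  open HeytingAlgebraProperties heytingAlgebra using (⇨ˡ-contravariant)
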